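{- Let $m \geq 2$ and let $U(m)$ be the set of invertible elements of $\mathbb{Z}/2^{m}\mathbb{Z}$. Then \[\left|\{(x,y) \in ((\mathbb{Z}/2^{m}\mathbb{Z})\setminus U(m))^{2}:~xy=0\}\right|=m2^{m-1}.\] -}

module Defs where

open import Data.Nat using (ℕ; suc; _^_; NonZero)
import Data.Nat as ℕ
open import Data.Nat.DivMod using (_mod_)
open import Data.Fin using (Fin; toℕ; zero)
open import Data.Fin.Properties using (any?; _≟_)
open import Data.Product using (_×_; _,_; ∃)
open import Data.List using (List; filter; length; cartesianProduct; allFin)
open import Relation.Nullary using (Dec; ¬_; ¬?)
open import Relation.Nullary.Decidable using (_×-dec_)
open import Relation.Binary.PropositionalEquality using (_≡_)

-- The ring ℤ/nℤ, modelled as Fin n with arithmetic mod n.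
ℤmod : ℕ → Set
ℤmod n = Fin n

_·_ : ∀ {n} .{{_ : NonZero n}} → ℤmod n → ℤmod n → ℤmod n
_·_ {n} x y = (toℕ x ℕ.* toℕ y) mod n

one : ∀ {n} .{{_ : NonZero n}} → ℤmod n
one {n} = 1 mod n

zer : ∀ {n} .{{_ : NonZero n}} → ℤmod n
zer {n} = 0 mod n

IsUnit : ∀ {n} .{{_ : NonZero n}} → ℤmod n → Set
IsUnit {n} x = ∃ λ (y : ℤmod n) → x · y ≡ one

isUnit? : ∀ {n} .{{_ : NonZero n}} (x : ℤmod n) → Dec (IsUnit x)
isUnit? x = any? (λ y → (x · y) ≟ one)

-- The set { (x,y) ∈ ((ℤ/nℤ) \ U)² : x y = 0 } as a list (no duplicates)
nonUnitZeroPairs : ∀ n .{{_ : NonZero n}} → List (ℤmod n × ℤmod n)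
nonUnitZeroPairs n = filter
  (λ { (x , y) → (¬? (isUnit? x) ×-dec ¬? (isUnit? y)) ×-dec ((x · y) ≟ zer) })
  (cartesianProduct (allFin n) (allFin n))

nonUnitZeroPairs2^ : (m : ℕ) → List (ℤmod (2 ^ m) × ℤmod (2 ^ m))
nonUnitZeroPairs2^ m = nonUnitZeroPairs (2 ^ m) {{m^n≢0 2 m}}
  where open import Data.Nat.Properties using (m^n≢0)

{-# OPTIONS --safe #-}
module Submission where

-- In ℤ/2^m (m ≥ 1) an element is a unit iff its representative is odd (Bézout), and x y = 0
-- iff 2^m divides the product of the representatives; so we count pairs of even x, y < 2^m
-- with 2^m ∣ x y.
-- Let A_n(a) = #{y < n : n ∣ a y} and Z(k) = Σ_{a < 2^k} A_{2^k}(a). An odd a has A_{2^k}(a) = 1,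
-- and A_{2n}(2a) = 2 A_n(a) because y ↦ [n ∣ a y] is n-periodic. Splitting Z(k+1) by the
-- parity of a gives Z(k+1) = 2 Z(k) + 2^k, i.e. 2 Z(k) = (k+2) 2^k. For m = k+2 the counted
-- pairs are x = 2a, y = 2b with 2^(k+1) ∣ 2a b, and there are
-- Σ_{a < 2^(k+1)} A_{2^(k+1)}(2a) = 2 Σ_{a < 2^(k+1)} A_{2^k}(a) = 4 Z(k) = m 2^(m-1) of them,
-- the last sum by periodicity of A_{2^k}.

open import Defs
open import Data.Nat using (ℕ; _≤_; _^_; _*_; _∸_)
open import Data.List using (length)
open import Relation.Binary.PropositionalEquality using (_≡_)

open import Data.Bool using (true; false; if_then_else_)
open import Data.Fin using (Fin; toℕ)
import Data.Fin as Fin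
open import Data.Fin.Properties using (toℕ-fromℕ<; toℕ-injective)
open import Data.List using (List; []; _∷_; map; _++_; filter; cartesianProduct; allFin; tabulate)
open import Data.List.Properties using (map-++; map-∘; map-tabulate)
open import Data.Nat using (zero; suc; _+_; _<_; NonZero; z≤n; s≤s; z<s; s<s)
open import Data.Nat.Coprimality using (Coprime; coprime-Bézout; coprime-divisor)
import Data.Nat.Coprimality as Coprimality
open import Data.Nat.DivMod using (_%_; _mod_; [m+kn]%n≡m%n; %-distribˡ-*; m%n%n≡m%n)
open import Data.Nat.Divisibility
  using (_∣_; _∤_; _∣?_; _∣0; ∣-trans; ∣1⇒≡1; ∣⇒≤; m∣m*n; n∣m*n; ∣m∣n⇒∣m+n; ∣m+n∣m⇒∣n;
         *-cancelˡ-∣; *-monoʳ-∣; m%n≡0⇒n∣m; n∣m⇒m%n≡0; ∣n∣m%n⇒∣m; %-presˡ-∣)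
open import Data.Nat.GCD using (module Bézout)
open import Data.Nat.ListAction using (sum)
open import Data.Nat.ListAction.Properties using (sum-++)
open import Data.Nat.Primality using (prime[2]; prime⇒irreducible)
open import Data.Nat.Properties
  using (+-assoc; +-comm; +-identityʳ; *-comm; *-assoc; *-suc; *-zeroʳ; *-identityʳ; *-distribˡ-+; <⇒≱; m^n≢0;
         *-commutativeSemigroup)
open import Data.Nat.Tactic.RingSolver using (solve-∀)
import Algebra.Properties.CommutativeSemigroup *-commutativeSemigroup as *-CS
open import Data.Product using (_×_; _,_; ∃)
open import Data.Product.Function.NonDependent.Propositional using (_×-⇔_)
open import Data.Sum using (inj₁; inj₂)
open import Function using (_∘_; id; _⇔_; mk⇔; Equivalence)
import Function.Properties.Equivalence as ⇔
open import Relation.Nullary using (Dec; does; ¬_; contradiction)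
open import Relation.Nullary.Decidable using (_×-dec_; dec-true; dec-false; does-⇔; decidable-stable)
open import Relation.Unary using (Pred; Decidable)
open import Relation.Binary.PropositionalEquality using (refl; sym; trans; cong; cong₂; subst; module ≡-Reasoning)
open ≡-Reasoning

𝟙 : ∀ {a} {A : Set a} → Dec A → ℕ
𝟙 a? = if does a? then 1 else 0

module _ {a} {A : Set a} where

  𝟙-yes : (a? : Dec A) → A → 𝟙 a? ≡ 1
  𝟙-yes a? x = cong (if_then 1 else 0) (dec-true a? x)

  𝟙-no : (a? : Dec A) → ¬ A → 𝟙 a? ≡ 0
  𝟙-no a? ¬x = cong (if_then 1 else 0) (dec-false a? ¬x)

  𝟙-⇔ : ∀ {b} {B : Set b} → A ⇔ B → (a? : Dec A) (b? : Dec B) → 𝟙 a? ≡ 𝟙 b?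
  𝟙-⇔ A⇔B a? b? = cong (if_then 1 else 0) (does-⇔ A⇔B a? b?)

∑ : ℕ → (ℕ → ℕ) → ℕ
∑ zero    f = 0
∑ (suc n) f = f 0 + ∑ n (f ∘ suc)

infix 5 ∑
syntax ∑ n (λ i → e) = ∑[ i < n ] e

∑-cong : ∀ n {f g : ℕ → ℕ} → (∀ i → i < n → f i ≡ g i) → ∑ n f ≡ ∑ n g
∑-cong zero    f≗g = refl
∑-cong (suc n) f≗g = cong₂ _+_ (f≗g 0 z<s) (∑-cong n (λ i i<n → f≗g (suc i) (s<s i<n)))

∑-const : ∀ n c → ∑ n (λ _ → c) ≡ n * c
∑-const zero    c = refl
∑-const (suc n) c = cong (c +_) (∑-const n c)

∑-zero : ∀ n {f : ℕ → ℕ} → (∀ i → i < n → f i ≡ 0) → ∑ n f ≡ 0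
∑-zero n f≗0 = trans (∑-cong n f≗0) (trans (∑-const n 0) (*-zeroʳ n))

*-distribˡ-∑ : ∀ c n (f : ℕ → ℕ) → c * ∑ n f ≡ ∑[ i < n ] c * f i
*-distribˡ-∑ c zero    f = *-zeroʳ c
*-distribˡ-∑ c (suc n) f = trans (*-distribˡ-+ c (f 0) _) (cong (c * f 0 +_) (*-distribˡ-∑ c n (f ∘ suc)))

∑-+ : ∀ m n (f : ℕ → ℕ) → ∑ (m + n) f ≡ ∑ m f + (∑[ i < n ] f (m + i))
∑-+ zero    n f = refl
∑-+ (suc m) n f = trans (cong (f 0 +_) (∑-+ m n (f ∘ suc))) (sym (+-assoc (f 0) _ _))

∑-periodic : ∀ n (f : ℕ → ℕ) → (∀ i → f (n + i) ≡ f i) → ∑ (2 * n) f ≡ 2 * ∑ n f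
∑-periodic n f periodic = begin
  ∑ (n + (n + 0)) f                   ≡⟨ ∑-+ n (n + 0) f ⟩
  ∑ n f + (∑[ i < n + 0 ] f (n + i))  ≡⟨ cong (∑ n f +_) (∑-cong (n + 0) (λ i _ → periodic i)) ⟩
  ∑ n f + ∑ (n + 0) f                 ≡⟨ cong (∑ n f +_) (∑-+ n 0 f) ⟩
  ∑ n f + (∑ n f + 0)                 ∎

∑-even-odd : ∀ n (f : ℕ → ℕ) → ∑ (2 * n) f ≡ (∑[ i < n ] f (2 * i)) + (∑[ i < n ] f (suc (2 * i)))
∑-even-odd zero    f = refl
∑-even-odd (suc n) f = begin
  ∑ (2 * suc n) f
    ≡⟨ cong (λ m → ∑ m f) (*-suc 2 n) ⟩
  f 0 + (f 1 + ∑ (2 * n) (f ∘ suc ∘ suc))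
    ≡⟨ cong (λ s → f 0 + (f 1 + s)) (∑-even-odd n (f ∘ suc ∘ suc)) ⟩
  f 0 + (f 1 + ((∑[ i < n ] f (2 + 2 * i)) + (∑[ i < n ] f (3 + 2 * i))))
    ≡⟨ interchange (f 0) (f 1) _ _ ⟩
  (f 0 + (∑[ i < n ] f (2 + 2 * i))) + (f 1 + (∑[ i < n ] f (3 + 2 * i)))
    ≡⟨ cong₂ (λ s t → (f 0 + s) + (f 1 + t))
             (∑-cong n (λ i _ → cong f (sym (*-suc 2 i))))
             (∑-cong n (λ i _ → cong (f ∘ suc) (sym (*-suc 2 i)))) ⟩
  (f 0 + (∑[ i < n ] f (2 * suc i))) + (f 1 + (∑[ i < n ] f (suc (2 * suc i))))
    ∎
  where
  interchange : ∀ a b c d → a + (b + (c + d)) ≡ (a + c) + (b + d)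
  interchange = solve-∀

∑-evens : ∀ n (f : ℕ → ℕ) → (∀ i → f (suc (2 * i)) ≡ 0) → ∑ (2 * n) f ≡ ∑[ i < n ] f (2 * i)
∑-evens n f odd≡0 = begin
  ∑ (2 * n) f                                            ≡⟨ ∑-even-odd n f ⟩
  (∑[ i < n ] f (2 * i)) + (∑[ i < n ] f (suc (2 * i)))  ≡⟨ cong (evens +_) (∑-zero n (λ i _ → odd≡0 i)) ⟩
  evens + 0                                              ≡⟨ +-identityʳ evens ⟩
  evens                                                  ∎
  where
  evens : ℕ
  evens = ∑[ i < n ] f (2 * i)

length-filter≡sum-𝟙 : ∀ {a p} {A : Set a} {P : Pred A p} (P? : Decidable P) (xs : List A) →
                      length (filter P? xs) ≡ sum (map (𝟙 ∘ P?) xs)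
length-filter≡sum-𝟙 P? []       = refl
length-filter≡sum-𝟙 P? (x ∷ xs) with does (P? x)
... | true  = cong suc (length-filter≡sum-𝟙 P? xs)
... | false = length-filter≡sum-𝟙 P? xs

sum-map-cartesianProduct : ∀ {a b} {A : Set a} {B : Set b} (g : A × B → ℕ) (xs : List A) (ys : List B) →
                           sum (map g (cartesianProduct xs ys)) ≡ sum (map (λ x → sum (map (λ y → g (x , y)) ys)) xs)
sum-map-cartesianProduct g []       ys = refl
sum-map-cartesianProduct g (x ∷ xs) ys = begin
  sum (map g (map (x ,_) ys ++ cartesianProduct xs ys))
    ≡⟨ cong sum (map-++ g (map (x ,_) ys) _) ⟩
  sum (map g (map (x ,_) ys) ++ map g (cartesianProduct xs ys))
    ≡⟨ sum-++ (map g (map (x ,_) ys)) _ ⟩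
  sum (map g (map (x ,_) ys)) + sum (map g (cartesianProduct xs ys))
    ≡⟨ cong₂ _+_ (cong sum (sym (map-∘ ys))) (sum-map-cartesianProduct g xs ys) ⟩
  sum (map (λ y → g (x , y)) ys) + sum (map (λ x → sum (map (λ y → g (x , y)) ys)) xs)
    ∎

sum-tabulate : ∀ {n} (g : Fin n → ℕ) {h : ℕ → ℕ} → (∀ x → g x ≡ h (toℕ x)) → sum (tabulate g) ≡ ∑ n h
sum-tabulate {zero}  g g≗h = refl
sum-tabulate {suc n} g g≗h = cong₂ _+_ (g≗h Fin.zero) (sum-tabulate (g ∘ Fin.suc) (g≗h ∘ Fin.suc))

sum-map-allFin : ∀ {n} (g : Fin n → ℕ) {h : ℕ → ℕ} → (∀ x → g x ≡ h (toℕ x)) → sum (map g (allFin n)) ≡ ∑ n h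
sum-map-allFin g g≗h = trans (cong sum (map-tabulate id g)) (sum-tabulate g g≗h)

length-filter-allFin² : ∀ {n p r} {P : Pred (Fin n × Fin n) p} (P? : Decidable P)
                        {R : ℕ → ℕ → Set r} (R? : ∀ i j → Dec (R i j)) →
                        (∀ x y → P (x , y) ⇔ R (toℕ x) (toℕ y)) →
                        length (filter P? (cartesianProduct (allFin n) (allFin n))) ≡ ∑[ i < n ] ∑[ j < n ] 𝟙 (R? i j)
length-filter-allFin² {n} P? R? P⇔R = begin
  length (filter P? (cartesianProduct (allFin n) (allFin n)))
    ≡⟨ length-filter≡sum-𝟙 P? (cartesianProduct (allFin n) (allFin n)) ⟩
  sum (map (𝟙 ∘ P?) (cartesianProduct (allFin n) (allFin n)))
    ≡⟨ sum-map-cartesianProduct (𝟙 ∘ P?) (allFin n) (allFin n) ⟩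
  sum (map (λ x → sum (map (λ y → 𝟙 (P? (x , y))) (allFin n))) (allFin n))
    ≡⟨ sum-map-allFin _ (λ x → sum-map-allFin _ (λ y → 𝟙-⇔ (P⇔R x y) (P? (x , y)) (R? (toℕ x) (toℕ y)))) ⟩
  ∑[ i < n ] ∑[ j < n ] 𝟙 (R? i j)
    ∎

2∤1+2*a : ∀ a → 2 ∤ 1 + 2 * a
2∤1+2*a a 2∣1+2a = contradiction (∣1⇒≡1 (∣m+n∣m⇒∣n 2∣2a+1 (m∣m*n a))) λ ()
  where
  2∣2a+1 : 2 ∣ 2 * a + 1
  2∣2a+1 = subst (2 ∣_) (+-comm 1 (2 * a)) 2∣1+2a

2∤⇒coprime-2^ : ∀ j {a} → 2 ∤ a → Coprime a (2 ^ j)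
2∤⇒coprime-2^ zero    2∤a (_ , d∣1)        = ∣1⇒≡1 d∣1
2∤⇒coprime-2^ (suc j) 2∤a (d∣a , d∣2*2^j) = 2∤⇒coprime-2^ j 2∤a (d∣a , coprime-divisor d⊥2 d∣2*2^j)
  where
  d⊥2 : Coprime _ 2
  d⊥2 (e∣d , e∣2) with prime⇒irreducible prime[2] e∣2
  ... | inj₁ e≡1 = e≡1
  ... | inj₂ refl = contradiction (∣-trans e∣d d∣a) 2∤a

coprime-2^[1+j]⇔2∤ : ∀ j a → Coprime a (2 ^ suc j) ⇔ 2 ∤ a
coprime-2^[1+j]⇔2∤ j a = mk⇔ (λ a⊥2^[1+j] 2∣a → contradiction (a⊥2^[1+j] (2∣a , m∣m*n (2 ^ j))) λ ())
                              (2∤⇒coprime-2^ (suc j))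

∣*-periodicʳ : ∀ n a b → n ∣ a * (n + b) ⇔ n ∣ a * b
∣*-periodicʳ n a b = mk⇔ (λ n∣ → ∣m+n∣m⇒∣n (subst (n ∣_) distrib n∣) (n∣m*n a))
                         (λ n∣ → subst (n ∣_) (sym distrib) (∣m∣n⇒∣m+n (n∣m*n a) n∣))
  where
  distrib : a * (n + b) ≡ a * n + a * b
  distrib = *-distribˡ-+ a n b

∣*-periodicˡ : ∀ n a b → n ∣ (n + a) * b ⇔ n ∣ a * b
∣*-periodicˡ n a b rewrite *-comm (n + a) b | *-comm a b = ∣*-periodicʳ n b a

*-cancelˡ-∣-⇔ : ∀ o .{{_ : NonZero o}} {m n} → o * m ∣ o * n ⇔ m ∣ n
*-cancelˡ-∣-⇔ o = mk⇔ (*-cancelˡ-∣ o) (*-monoʳ-∣ o)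

inverse-mod : ∀ {c n} .{{_ : NonZero n}} → Coprime c n → ∃ λ a → c * a % n ≡ 1 % n
inverse-mod {c} {n} c⊥n with coprime-Bézout c⊥n
... | Bézout.+- a b 1+bn≡ac = a , (begin
  c * a % n        ≡⟨ cong (_% n) (trans (*-comm c a) (sym 1+bn≡ac)) ⟩
  (1 + b * n) % n  ≡⟨ [m+kn]%n≡m%n 1 b n ⟩
  1 % n            ∎)
-- Here c a ≡ -1 (mod n), so a (n - 1) inverts c.
inverse-mod {c} {n@(suc p)} c⊥n | Bézout.-+ a b 1+ac≡bn = a * p , (begin
  c * (a * p) % n                  ≡⟨ [m+kn]%n≡m%n (c * (a * p)) b n ⟨
  (c * (a * p) + b * n) % n        ≡⟨ cong (λ bn → (c * (a * p) + bn) % n) 1+ac≡bn ⟨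
  (c * (a * p) + (1 + a * c)) % n  ≡⟨ cong (_% n) (regroup c a p) ⟩
  (1 + c * a * n) % n              ≡⟨ [m+kn]%n≡m%n 1 (c * a) n ⟩
  1 % n                            ∎)
  where
  regroup : ∀ c a p → c * (a * p) + (1 + a * c) ≡ 1 + c * a * suc p
  regroup = solve-∀

module _ {n : ℕ} .{{_ : NonZero n}} where

  toℕ-mod : ∀ a → toℕ (a mod n) ≡ a % n
  toℕ-mod a = toℕ-fromℕ< _

  toℕ-· : (x y : ℤmod n) → toℕ (x · y) ≡ toℕ x * toℕ y % n
  toℕ-· x y = toℕ-mod (toℕ x * toℕ y)

  toℕ-zer : toℕ (zer {n}) ≡ 0
  toℕ-zer = trans (toℕ-mod 0) (n∣m⇒m%n≡0 0 n (n ∣0))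

  ·≡zer⇔∣ : (x y : ℤmod n) → x · y ≡ zer ⇔ n ∣ toℕ x * toℕ y
  ·≡zer⇔∣ x y = mk⇔
    (λ xy≡0 → m%n≡0⇒n∣m _ n (trans (sym (toℕ-· x y)) (trans (cong toℕ xy≡0) toℕ-zer)))
    (λ n∣xy → toℕ-injective (trans (toℕ-· x y) (trans (n∣m⇒m%n≡0 _ n n∣xy) (sym toℕ-zer))))

  isUnit⇔coprime : (x : ℤmod n) → IsUnit x ⇔ Coprime (toℕ x) n
  isUnit⇔coprime x = mk⇔ unit⇒coprime coprime⇒unit
    where
    unit⇒coprime : IsUnit x → Coprime (toℕ x) n
    unit⇒coprime (y , xy≡1) {d} (d∣x , d∣n) = ∣1⇒≡1 (∣n∣m%n⇒∣m d∣n (subst (d ∣_) xy%n≡1%n d∣xy%n))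
      where
      xy%n≡1%n : toℕ x * toℕ y % n ≡ 1 % n
      xy%n≡1%n = trans (sym (toℕ-· x y)) (trans (cong toℕ xy≡1) (toℕ-mod 1))
      d∣xy%n : d ∣ toℕ x * toℕ y % n
      d∣xy%n = %-presˡ-∣ (∣-trans d∣x (m∣m*n (toℕ y))) d∣n

    coprime⇒unit : Coprime (toℕ x) n → IsUnit x
    coprime⇒unit x⊥n with a , xa%n≡1%n ← inverse-mod x⊥n = a mod n , toℕ-injective (begin
      toℕ (x · (a mod n))                 ≡⟨ toℕ-· x (a mod n) ⟩
      toℕ x * toℕ (a mod n) % n           ≡⟨ cong (λ a′ → toℕ x * a′ % n) (toℕ-mod a) ⟩
      toℕ x * (a % n) % n                 ≡⟨ %-distribˡ-* (toℕ x) (a % n) n ⟩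
      toℕ x % n * (a % n % n) % n         ≡⟨ cong (λ a′ → toℕ x % n * a′ % n) (m%n%n≡m%n a n) ⟩
      toℕ x % n * (a % n) % n             ≡⟨ sym (%-distribˡ-* (toℕ x) a n) ⟩
      toℕ x * a % n                       ≡⟨ xa%n≡1%n ⟩
      1 % n                               ≡⟨ sym (toℕ-mod 1) ⟩
      toℕ (one {n})                       ∎)

annihilatorSize : ℕ → ℕ → ℕ
annihilatorSize n a = ∑[ y < n ] 𝟙 (n ∣? a * y)

annihilatorSize-coprime : ∀ n .{{_ : NonZero n}} {a} → Coprime a n → annihilatorSize n a ≡ 1
annihilatorSize-coprime n@(suc p) {a} a⊥n = cong₂ _+_
  (𝟙-yes (n ∣? a * 0) (subst (n ∣_) (sym (*-zeroʳ a)) (n ∣0)))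
  (∑-zero p (λ i i<p → 𝟙-no (n ∣? a * suc i) (λ n∣a[1+i] → <⇒≱ (s<s i<p) (∣⇒≤ (n∣1+i n∣a[1+i])))))
  where
  n∣1+i : ∀ {i} → n ∣ a * suc i → n ∣ suc i
  n∣1+i = coprime-divisor (Coprimality.sym a⊥n)

annihilatorSize-periodic : ∀ n a → annihilatorSize n (n + a) ≡ annihilatorSize n a
annihilatorSize-periodic n a = ∑-cong n (λ y _ → 𝟙-⇔ (∣*-periodicˡ n a y) (n ∣? (n + a) * y) (n ∣? a * y))

annihilatorSize-2* : ∀ n a → annihilatorSize (2 * n) (2 * a) ≡ 2 * annihilatorSize n a
annihilatorSize-2* n a = trans (∑-cong (2 * n) cancel-2) (∑-periodic n (λ y → 𝟙 (n ∣? a * y)) periodic)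
  where
  periodic : ∀ y → 𝟙 (n ∣? a * (n + y)) ≡ 𝟙 (n ∣? a * y)
  periodic y = 𝟙-⇔ (∣*-periodicʳ n a y) (n ∣? a * (n + y)) (n ∣? a * y)

  cancel-2 : ∀ y → y < 2 * n → 𝟙 (2 * n ∣? 2 * a * y) ≡ 𝟙 (n ∣? a * y)
  cancel-2 y _ = trans (cong (λ z → 𝟙 (2 * n ∣? z)) (*-assoc 2 a y))
                       (𝟙-⇔ (*-cancelˡ-∣-⇔ 2) (2 * n ∣? 2 * (a * y)) (n ∣? a * y))

zeroProducts : ℕ → ℕ
zeroProducts k = ∑[ x < 2 ^ k ] annihilatorSize (2 ^ k) x

zeroProducts-suc : ∀ k → zeroProducts (suc k) ≡ 2 * zeroProducts k + 2 ^ k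
zeroProducts-suc k = begin
  zeroProducts (suc k)
    ≡⟨ ∑-even-odd (2 ^ k) (annihilatorSize (2 ^ suc k)) ⟩
  (∑[ a < 2 ^ k ] annihilatorSize (2 ^ suc k) (2 * a)) +
  (∑[ a < 2 ^ k ] annihilatorSize (2 ^ suc k) (1 + 2 * a))
    ≡⟨ cong₂ _+_ (∑-cong (2 ^ k) (λ a _ → annihilatorSize-2* (2 ^ k) a))
                 (∑-cong (2 ^ k) (λ a _ → annihilatorSize-odd a)) ⟩
  (∑[ a < 2 ^ k ] 2 * annihilatorSize (2 ^ k) a) + (∑[ a < 2 ^ k ] 1)
    ≡⟨ cong₂ _+_ (sym (*-distribˡ-∑ 2 (2 ^ k) (annihilatorSize (2 ^ k)))) (∑-const (2 ^ k) 1) ⟩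
  2 * zeroProducts k + 2 ^ k * 1
    ≡⟨ cong (2 * zeroProducts k +_) (*-identityʳ (2 ^ k)) ⟩
  2 * zeroProducts k + 2 ^ k
    ∎
  where
  annihilatorSize-odd : ∀ a → annihilatorSize (2 ^ suc k) (1 + 2 * a) ≡ 1
  annihilatorSize-odd a = annihilatorSize-coprime (2 ^ suc k) {{m^n≢0 2 (suc k)}}
                                                  (2∤⇒coprime-2^ (suc k) (2∤1+2*a a))

zeroProducts-closed : ∀ k → 2 * zeroProducts k ≡ (2 + k) * 2 ^ k
zeroProducts-closed zero    = refl
zeroProducts-closed (suc k) = begin
  2 * zeroProducts (suc k)              ≡⟨ cong (2 *_) (zeroProducts-suc k) ⟩
  2 * (2 * zeroProducts k + 2 ^ k)      ≡⟨ *-distribˡ-+ 2 (2 * zeroProducts k) (2 ^ k) ⟩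
  2 * (2 * zeroProducts k) + 2 ^ suc k  ≡⟨ cong (λ z → 2 * z + 2 ^ suc k) (zeroProducts-closed k) ⟩
  2 * ((2 + k) * 2 ^ k) + 2 ^ suc k     ≡⟨ regroup k (2 ^ k) ⟩
  (3 + k) * 2 ^ suc k                   ∎
  where
  regroup : ∀ k x → 2 * ((2 + k) * x) + 2 * x ≡ (3 + k) * (2 * x)
  regroup = solve-∀

EvenZeroProduct : ℕ → ℕ → ℕ → Set
EvenZeroProduct m x y = (2 ∣ x × 2 ∣ y) × 2 ^ m ∣ x * y

evenZeroProduct? : ∀ m x y → Dec (EvenZeroProduct m x y)
evenZeroProduct? m x y = (2 ∣? x ×-dec 2 ∣? y) ×-dec 2 ^ m ∣? x * y

evenZeroProduct[2a,2b]⇔ : ∀ k a b → EvenZeroProduct (suc k) (2 * a) (2 * b) ⇔ 2 ^ k ∣ 2 * a * b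
evenZeroProduct[2a,2b]⇔ k a b = mk⇔
  (λ (_ , 2^[1+k]∣2a*2b) → to (subst (2 ^ suc k ∣_) 2a*2b≡2[2a*b] 2^[1+k]∣2a*2b))
  (λ 2^k∣2a*b → (m∣m*n a , m∣m*n b) , subst (2 ^ suc k ∣_) (sym 2a*2b≡2[2a*b]) (from 2^k∣2a*b))
  where
  open Equivalence (*-cancelˡ-∣-⇔ 2)
  2a*2b≡2[2a*b] : 2 * a * (2 * b) ≡ 2 * (2 * a * b)
  2a*2b≡2[2a*b] = *-CS.x∙yz≈y∙xz (2 * a) 2 b

evenZeroProducts : ℕ → ℕ
evenZeroProducts m = ∑[ x < 2 ^ m ] ∑[ y < 2 ^ m ] 𝟙 (evenZeroProduct? m x y)

evenZeroProducts-suc : ∀ k → evenZeroProducts (suc k) ≡ ∑[ a < 2 ^ k ] annihilatorSize (2 ^ k) (2 * a)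
evenZeroProducts-suc k = trans
  (∑-evens (2 ^ k) row (λ a → ∑-zero (2 ^ suc k) (λ y _ → 𝟙-no (evenZeroProduct? (suc k) (1 + 2 * a) y)
                                                               (λ ((2∣x , _) , _) → 2∤1+2*a a 2∣x))))
  (∑-cong (2 ^ k) (λ a _ → row-2* a))
  where
  row : ℕ → ℕ
  row x = ∑[ y < 2 ^ suc k ] 𝟙 (evenZeroProduct? (suc k) x y)

  row-2* : ∀ a → row (2 * a) ≡ annihilatorSize (2 ^ k) (2 * a)
  row-2* a = trans
    (∑-evens (2 ^ k) (λ y → 𝟙 (evenZeroProduct? (suc k) (2 * a) y))
                     (λ b → 𝟙-no (evenZeroProduct? (suc k) (2 * a) (1 + 2 * b)) (λ ((_ , 2∣y) , _) → 2∤1+2*a b 2∣y)))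
    (∑-cong (2 ^ k) (λ b _ → 𝟙-⇔ (evenZeroProduct[2a,2b]⇔ k a b)
                                  (evenZeroProduct? (suc k) (2 * a) (2 * b)) (2 ^ k ∣? 2 * a * b)))

evenZeroProducts-2+ : ∀ k → evenZeroProducts (2 + k) ≡ 4 * zeroProducts k
evenZeroProducts-2+ k = begin
  evenZeroProducts (2 + k)
    ≡⟨ evenZeroProducts-suc (suc k) ⟩
  ∑[ a < 2 ^ suc k ] annihilatorSize (2 ^ suc k) (2 * a)
    ≡⟨ ∑-cong (2 ^ suc k) (λ a _ → annihilatorSize-2* (2 ^ k) a) ⟩
  ∑[ a < 2 * 2 ^ k ] 2 * annihilatorSize (2 ^ k) a
    ≡⟨ *-distribˡ-∑ 2 (2 * 2 ^ k) (annihilatorSize (2 ^ k)) ⟨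
  2 * (∑[ a < 2 * 2 ^ k ] annihilatorSize (2 ^ k) a)
    ≡⟨ cong (2 *_) (∑-periodic (2 ^ k) (annihilatorSize (2 ^ k)) (annihilatorSize-periodic (2 ^ k))) ⟩
  2 * (2 * zeroProducts k)
    ≡⟨ *-assoc 2 2 (zeroProducts k) ⟨
  4 * zeroProducts k
    ∎

module _ (j : ℕ) where

  private instance
    2^[1+j]-nonZero : NonZero (2 ^ suc j)
    2^[1+j]-nonZero = m^n≢0 2 (suc j)

  nonUnit⇔2∣ : (x : ℤmod (2 ^ suc j)) → (¬ IsUnit x) ⇔ 2 ∣ toℕ x
  nonUnit⇔2∣ x = mk⇔
    (λ ¬unit → decidable-stable (2 ∣? toℕ x) (¬unit ∘ Equivalence.from unit⇔2∤))
    (λ 2∣x unit → Equivalence.to unit⇔2∤ unit 2∣x)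
    where
    unit⇔2∤ : IsUnit x ⇔ 2 ∤ toℕ x
    unit⇔2∤ = ⇔.trans (isUnit⇔coprime x) (coprime-2^[1+j]⇔2∤ j (toℕ x))

  nonUnitZeroPair⇔ : (x y : ℤmod (2 ^ suc j)) →
                     ((¬ IsUnit x × ¬ IsUnit y) × x · y ≡ zer) ⇔ EvenZeroProduct (suc j) (toℕ x) (toℕ y)
  nonUnitZeroPair⇔ x y = (nonUnit⇔2∣ x ×-⇔ nonUnit⇔2∣ y) ×-⇔ ·≡zer⇔∣ x y

lemma2p7 : (m : ℕ) → 2 ≤ m → length (nonUnitZeroPairs2^ m) ≡ m * 2 ^ (m ∸ 1)
lemma2p7 (suc (suc k)) (s≤s (s≤s z≤n)) = begin
  length (nonUnitZeroPairs2^ (2 + k))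
    ≡⟨ length-filter-allFin² _ (evenZeroProduct? (2 + k)) (nonUnitZeroPair⇔ (suc k)) ⟩
  evenZeroProducts (2 + k)
    ≡⟨ evenZeroProducts-2+ k ⟩
  4 * zeroProducts k
    ≡⟨ *-assoc 2 2 (zeroProducts k) ⟩
  2 * (2 * zeroProducts k)
    ≡⟨ cong (2 *_) (zeroProducts-closed k) ⟩
  2 * ((2 + k) * 2 ^ k)
    ≡⟨ *-CS.x∙yz≈y∙xz 2 (2 + k) (2 ^ k) ⟩
  (2 + k) * 2 ^ suc k
    ∎
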